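{- Let $K$ be a finite simplicial complex, $s\ge1$, $S\subseteq F^s(K)$ a set of $s$-simplices of $K$, and $S_0$ a connected component of $S$. Then $S_0$ is closed if and only if $\{\sigma\in F^s(K)\mid \sigma\subseteq V(S_0)\}\subseteq S$.
   Context: $F^s(K)$ is the set of $s$-simplices (faces with $s+1$ vertices) of $K$. For $S\subseteq F^s(K)$, let $\sim$ be the smallest equivalence relation on $S$ with $\sigma_1\cap\sigma_2\neq\emptyset\Rightarrow\sigma_1\sim\sigma_2$; the connected components of $S$ are the equivalence classes. $V(S)=\bigcup S$ is the vertex set of $S$. A set $S\subseteq F^s(K)$ is closed if $\{\sigma\in F^s(K)\mid\sigma\subseteq V(S)\}=S$. -}

module Defs where

open import Data.Nat using (ℕ; suc)
open import Data.Fin using (Fin)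
open import Data.Fin.Subset using (Subset; _⊆_; _∈_; _∩_; Nonempty; ∣_∣)
open import Data.Product using (Σ; ∃; _×_)
open import Relation.Binary.PropositionalEquality using (_≡_)
open import Relation.Binary.Construct.Closure.Equivalence using (EqClosure)

record SimplicialComplex (n : ℕ) : Set₁ where
  field
    face        : Subset n → Set
    down-closed : ∀ {σ τ} → τ ⊆ σ → face σ → face τ
open SimplicialComplex public

SimplexSet : ℕ → Set₁
SimplexSet n = Subset n → Set

_⊆ˢ_ : ∀ {n} → SimplexSet n → SimplexSet n → Set
S ⊆ˢ T = ∀ σ → S σ → T σ

_≐ˢ_ : ∀ {n} → SimplexSet n → SimplexSet n → Set
S ≐ˢ T = (S ⊆ˢ T) × (T ⊆ˢ S)

F : ∀ {n} → ℕ → SimplicialComplex n → SimplexSet n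
F s K σ = face K σ × (∣ σ ∣ ≡ suc s)

V : ∀ {n} → SimplexSet n → Fin n → Set
V S x = ∃ λ σ → S σ × x ∈ σ

_⊆V_ : ∀ {n} → Subset n → SimplexSet n → Set
σ ⊆V S = ∀ x → x ∈ σ → V S x

Meets : ∀ {n} → SimplexSet n → Subset n → Subset n → Set
Meets S σ₁ σ₂ = S σ₁ × S σ₂ × Nonempty (σ₁ ∩ σ₂)

_∼[_]_ : ∀ {n} → Subset n → SimplexSet n → Subset n → Set
σ ∼[ S ] τ = EqClosure (Meets S) σ τ

ComponentOf : ∀ {n} → SimplexSet n → Subset n → SimplexSet n
ComponentOf S σ τ = S τ × (σ ∼[ S ] τ)

IsComponent : ∀ {n} → SimplexSet n → SimplexSet n → Set
IsComponent S S₀ = ∃ λ σ → S σ × (S₀ ≐ˢ ComponentOf S σ)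

SpannedBy : ∀ {n} → ℕ → SimplicialComplex n → SimplexSet n → SimplexSet n
SpannedBy s K S σ = F s K σ × (σ ⊆V S)

Closed : ∀ {n} → ℕ → SimplicialComplex n → SimplexSet n → Set
Closed s K S = SpannedBy s K S ≐ˢ S

-- A component absorbs every simplex of S that meets one of its simplices.
-- An s-simplex τ ⊆ V(S₀) is nonempty, so it meets some simplex of S₀; hence
-- τ ∈ S forces τ ∈ S₀.
module Submission where

open import Defs
open import Data.Nat using (ℕ; _≥_; suc)
open import Data.Nat.Properties using (1+n≢0)
open import Data.Product using (_×_; _,_; proj₁)
open import Data.Fin.Subset using (Subset; Nonempty; _∩_; ∣_∣)
open import Data.Fin.Subset.Properties using (nonempty?; Empty-unique; ∣⊥∣≡0; x∈p∩q⁺)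
open import Relation.Nullary using (yes; no)
open import Relation.Binary.PropositionalEquality using (_≡_; trans; sym; cong)
open import Relation.Binary.Construct.Closure.Equivalence using (return)
open import Relation.Binary.Construct.Closure.ReflexiveTransitive using (_◅◅_)
open import Data.Empty using (⊥-elim)

module _ {n : ℕ} where

  nonempty-if-∣∣≡suc : ∀ {τ : Subset n} {k} → ∣ τ ∣ ≡ suc k → Nonempty τ
  nonempty-if-∣∣≡suc {τ} eq with nonempty? τ
  ... | yes ne = ne
  ... | no ¬ne = ⊥-elim (1+n≢0 (trans (sym eq) (trans (cong ∣_∣ (Empty-unique ¬ne)) (∣⊥∣≡0 n))))

  component-⊆ : ∀ {S S₀ : SimplexSet n} → IsComponent S S₀ → S₀ ⊆ˢ S
  component-⊆ (_ , _ , to , _) τ S₀τ = proj₁ (to τ S₀τ)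

  component-absorbs-meeting : ∀ {S S₀ : SimplexSet n} → IsComponent S S₀ →
    ∀ {ρ τ} → S₀ ρ → S τ → Nonempty (ρ ∩ τ) → S₀ τ
  component-absorbs-meeting (σ , _ , to , from) {ρ} {τ} S₀ρ Sτ ρ∩τ≢∅
    with Sρ , σ∼ρ ← to ρ S₀ρ
    = from τ (Sτ , σ∼ρ ◅◅ return (Sρ , Sτ , ρ∩τ≢∅))

  spanned-⊆-component : ∀ {s K} {S S₀ : SimplexSet n} → IsComponent S S₀ →
    ∀ {τ} → SpannedBy s K S₀ τ → S τ → S₀ τ
  spanned-⊆-component S₀-comp ((_ , ∣τ∣≡1+s) , τ⊆VS₀) Sτ
    with x , x∈τ ← nonempty-if-∣∣≡suc ∣τ∣≡1+s
    with ρ , S₀ρ , x∈ρ ← τ⊆VS₀ x x∈τ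
    = component-absorbs-meeting S₀-comp S₀ρ Sτ (x , x∈p∩q⁺ (x∈ρ , x∈τ))

  ⊆-spanned : ∀ {s K} {S₀ : SimplexSet n} → S₀ ⊆ˢ F s K → S₀ ⊆ˢ SpannedBy s K S₀
  ⊆-spanned S₀⊆F τ S₀τ = S₀⊆F τ S₀τ , λ x x∈τ → τ , S₀τ , x∈τ

lemma2p14 : (n : ℕ) (K : SimplicialComplex n) (s : ℕ) → s ≥ 1 →
    (S S₀ : SimplexSet n) → S ⊆ˢ F s K → IsComponent S S₀ →
    (Closed s K S₀ → SpannedBy s K S₀ ⊆ˢ S) × (SpannedBy s K S₀ ⊆ˢ S → Closed s K S₀)
lemma2p14 n K s _ S S₀ S⊆F S₀-comp =
  (λ (spanned⊆S₀ , _) τ sp → S₀⊆S τ (spanned⊆S₀ τ sp)) ,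
  (λ spanned⊆S →
    (λ τ sp → spanned-⊆-component {s = s} {K} S₀-comp sp (spanned⊆S τ sp)) ,
    ⊆-spanned {s = s} {K} (λ τ S₀τ → S⊆F τ (S₀⊆S τ S₀τ)))
  where
  S₀⊆S : S₀ ⊆ˢ S
  S₀⊆S = component-⊆ S₀-comp
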